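{- Let $B$ be a set. (i) For $T$ a predicate on $(\mathbb{N}\times B)^*$ closed under restriction, $T$ is $\mathbb{N}$-$B$-approximable if and only if $\|T\|$ is productive. (ii) For $T$ a predicate on $B^*$ that is a tree, the upward arborification of $\widehat{T}$ is $\mathbb{N}$-$B$-approximable if and only if $T$ is productive. (iii) For $T$ a predicate on $(\mathbb{N}\times B)^*$ closed under extension, $T$ is inductively $\mathbb{N}$-$B$-barred if and only if $\|T\|$ is inductively barred. (iv) For $T$ a predicate on $B^*$ that is monotone, the upward monotonisation of $\widehat{T}$ is inductively $\mathbb{N}$-$B$-barred if and only if $T$ is inductively barred.
   Context: Sequences over $B$: $B^*$ is the set of finite sequences, $\langle\rangle$ empty, $u\star b$ extension by $b$, $|u|$ length. A predicate $T$ on $B^*$ is a tree if $u\star b\in T\Rightarrow u\in T$, monotone if $u\in T\Rightarrow u\star b\in T$. The pruning of $T\subseteq B^*$ is the greatest $X$ with $X(u)\Rightarrow(u\in T\wedge\exists b\,X(u\star b))$ and $T$ is productive if $\langle\rangle$ is in it; the hereditary closure is the least $X$ with $X(u)$ whenever $u\in T$ or $\forall b\,X(u\star b)$, and $T$ is inductively barred if $\langle\rangle$ is in it. Approximations: for sets $A,B$, elements $v$ of $(A\times B)^*$ are finite sequences of pairs; $v\subseteq v'$ means every pair occurring in $v$ occurs in $v'$; $\mathrm{dom}(v)=\{a\mid\exists b,\ (a,b)\text{ occurs in }v\}$. For $T\subseteq (A\times B)^*$: $T$ is closed under restriction if $v'\subseteq v\in T\Rightarrow v'\in T$, closed under extension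 if $T\ni v\subseteq v'\Rightarrow v'\in T$; $T^{\downarrow}=\{v\mid\forall v'\subseteq v,\ v'\in T\}$; the upward monotonisation is $T^{\uparrow}=\{v\mid\exists v'\subseteq v,\ v'\in T\}$; the upward arborification is $\{v\mid\exists v'\,(v\subseteq v'\wedge v'\in T)\}$. $T$ is $A$-$B$-approximable if $\langle\rangle$ belongs to the greatest $X$ such that $X(v)$ implies $v\in T^{\downarrow}$ and $\forall a\notin\mathrm{dom}(v)\,\exists b\,X(v\star(a,b))$. $T$ is inductively $A$-$B$-barred if $\langle\rangle$ belongs to the least $X$ such that $X(v)$ holds whenever $v\in T^{\uparrow}$ or $\exists a\notin\mathrm{dom}(v)\,\forall b\,X(v\star(a,b))$. Translations: for $u\in B^*$, $\mathrm{ord}(u)\in(\mathbb{N}\times B)^*$ is defined by $\mathrm{ord}(\langle\rangle)=\langle\rangle$, $\mathrm{ord}(u\star b)=\mathrm{ord}(u)\star(|u|,b)$. For $T\subseteq(\mathbb{N}\times B)^*$, $\|T\|=\{u\in B^*\mid\mathrm{ord}(u)\in T\}$; for $T\subseteq B^*$, $\widehat{T}=\{v\mid\exists u\in T,\ v=\mathrm{ord}(u)\}$. -}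

module Defs where

open import Data.Nat using (ℕ)
open import Data.List using (List; []; _∷ʳ_; length; zip; upTo)
open import Data.List.Membership.Propositional using (_∈_)
open import Data.Product using (Σ; _×_; _,_; ∃)
open import Relation.Nullary using (¬_)
open import Relation.Binary.PropositionalEquality using (_≡_)

Pred : Set → Set₁
Pred A = A → Set

-- Sequences over B: finite lists, u ⋆ b is snoc (u ∷ʳ b).

module _ {B : Set} where

  IsTree : Pred (List B) → Set
  IsTree T = ∀ u b → T (u ∷ʳ b) → T u

  IsMonotone : Pred (List B) → Set
  IsMonotone T = ∀ u b → T u → T (u ∷ʳ b)

  -- Membership in the greatest X with X(u) ⇒ (u ∈ T ∧ ∃ b. X(u ⋆ b)):
  -- u is in the greatest fixed point iff it lies in some post-fixed point.
  Pruning : Pred (List B) → List B → Set₁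
  Pruning T u = Σ (Pred (List B)) λ X →
    X u × (∀ w → X w → T w × ∃ λ b → X (w ∷ʳ b))

  Productive : Pred (List B) → Set₁
  Productive T = Pruning T []

  data HereditaryClosure (T : Pred (List B)) : Pred (List B) where
    base : ∀ {u} → T u → HereditaryClosure T u
    step : ∀ {u} → (∀ b → HereditaryClosure T (u ∷ʳ b)) → HereditaryClosure T u

  InductivelyBarred : Pred (List B) → Set
  InductivelyBarred T = HereditaryClosure T []

module _ {A B : Set} where

  _⊑_ : List (A × B) → List (A × B) → Set
  v ⊑ v' = ∀ p → p ∈ v → p ∈ v'

  InDom : A → List (A × B) → Set
  InDom a v = ∃ λ b → (a , b) ∈ v

  ClosedUnderRestriction : Pred (List (A × B)) → Set
  ClosedUnderRestriction T = ∀ v v' → v' ⊑ v → T v → T v'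

  ClosedUnderExtension : Pred (List (A × B)) → Set
  ClosedUnderExtension T = ∀ v v' → T v → v ⊑ v' → T v'

  Down : Pred (List (A × B)) → Pred (List (A × B))
  Down T v = ∀ v' → v' ⊑ v → T v'

  UpMon : Pred (List (A × B)) → Pred (List (A × B))
  UpMon T v = ∃ λ v' → v' ⊑ v × T v'

  UpArb : Pred (List (A × B)) → Pred (List (A × B))
  UpArb T v = ∃ λ v' → v ⊑ v' × T v'

  ApproxGfp : Pred (List (A × B)) → List (A × B) → Set₁
  ApproxGfp T v = Σ (Pred (List (A × B))) λ X →
    X v × (∀ w → X w → Down T w ×
                   (∀ a → ¬ InDom a w → ∃ λ b → X (w ∷ʳ (a , b))))

  Approximable : Pred (List (A × B)) → Set₁
  Approximable T = ApproxGfp T []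

  data BarClosure (T : Pred (List (A × B))) : Pred (List (A × B)) where
    base : ∀ {v} → UpMon T v → BarClosure T v
    step : ∀ {v} a → ¬ InDom a v →
           (∀ b → BarClosure T (v ∷ʳ (a , b))) → BarClosure T v

  InductivelyABBarred : Pred (List (A × B)) → Set
  InductivelyABBarred T = BarClosure T []

module _ {B : Set} where

  ord : List B → List (ℕ × B)
  ord u = zip (upTo (length u)) u

  ‖_‖ : Pred (List (ℕ × B)) → Pred (List B)
  ‖ T ‖ u = T (ord u)

  hat : Pred (List B) → Pred (List (ℕ × B))
  hat T v = ∃ λ u → T u × v ≡ ord u

-- ord u records the first |u| values of u, and ord u ⊑ ord u′ holds exactly when u′
-- extends u.  A pruning Y of ‖ T ‖ therefore gives the approximable post-fixed point of
-- all v lying below some ord u with u ∈ Y: closure under restriction puts such v in T↓,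
-- and a query at index a is answered by extending u in Y beyond length a.  Dually, a bar
-- step at index a is simulated in B* by finitely many hereditary steps extending u beyond
-- a, and closure under extension carries T from v up to ord u.  Parts (ii) and (iv)
-- follow because ‖ UpArb (hat T) ‖ is T for a tree T, and ‖ UpMon (hat T) ‖ is T for a
-- monotone T.

module Submission where

open import Defs
open import Data.Nat using (ℕ; zero; suc; _+_; _≤_; _<_; z≤n; s≤s)
open import Data.Nat.Properties using (≤-refl; ≤-trans; n≮n; +-comm; +-suc; m≤m+n)
open import Data.List using (List; []; _∷_; _++_; _∷ʳ_; length; map; zip; upTo; applyUpTo)
open import Data.List.Properties using (map-upTo; zip-map; map-id; map-++; ++-assoc; ++-identityʳ; length-++)
open import Data.List.Membership.Propositional using (_∈_)
open import Data.List.Membership.Propositional.Properties using (∈-++⁺ˡ; ∈-++⁻; ∈-map⁺; ∈-map⁻)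
open import Data.List.Relation.Unary.Any using (here; there)
open import Data.Product using (_×_; _,_; ∃; proj₁; proj₂; map₁)
open import Data.Sum using (_⊎_; inj₁; inj₂)
open import Relation.Nullary using (¬_)
open import Function using (id)
open import Relation.Binary.PropositionalEquality using (_≡_; refl; sym; trans; cong; subst; module ≡-Reasoning)
open import Function.Bundles using (_⇔_; mk⇔; Equivalence)
open import Function.Properties.Equivalence using () renaming (trans to ⇔-trans)

module _ {B : Set} where

  shift : List (ℕ × B) → List (ℕ × B)
  shift = map (map₁ suc)

  ord-∷ : ∀ c u → ord (c ∷ u) ≡ (0 , c) ∷ shift (ord u)
  ord-∷ c u = cong ((0 , c) ∷_) (begin
    zip (applyUpTo suc (length u)) u          ≡⟨ cong (λ ns → zip ns u) (map-upTo suc (length u)) ⟨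
    zip (map suc (upTo (length u))) u         ≡⟨ cong (zip (map suc (upTo (length u)))) (map-id u) ⟨
    zip (map suc (upTo (length u))) (map id u) ≡⟨ zip-map suc id (upTo (length u)) u ⟩
    shift (ord u)                              ∎)
    where open ≡-Reasoning

  ord-∷ʳ : ∀ u b → ord (u ∷ʳ b) ≡ ord u ∷ʳ (length u , b)
  ord-∷ʳ []      b = refl
  ord-∷ʳ (c ∷ u) b = begin
    ord (c ∷ (u ∷ʳ b))                               ≡⟨ ord-∷ c (u ∷ʳ b) ⟩
    (0 , c) ∷ shift (ord (u ∷ʳ b))                   ≡⟨ cong (λ v → (0 , c) ∷ shift v) (ord-∷ʳ u b) ⟩
    (0 , c) ∷ shift (ord u ∷ʳ (length u , b))         ≡⟨ cong ((0 , c) ∷_) (map-++ (map₁ suc) (ord u) _) ⟩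
    ((0 , c) ∷ shift (ord u)) ∷ʳ (length (c ∷ u) , b) ≡⟨ cong (_∷ʳ (length (c ∷ u) , b)) (ord-∷ c u) ⟨
    ord (c ∷ u) ∷ʳ (length (c ∷ u) , b)               ∎
    where open ≡-Reasoning

  ∈-ord-∷⁺ : ∀ {q c u} → q ∈ ord u → map₁ suc q ∈ ord (c ∷ u)
  ∈-ord-∷⁺ {q} {c} {u} m = subst (map₁ suc q ∈_) (sym (ord-∷ c u)) (there (∈-map⁺ (map₁ suc) m))

  ∈-ord-∷⁻ : ∀ {p c u} → p ∈ ord (c ∷ u) → p ≡ (0 , c) ⊎ ∃ λ q → q ∈ ord u × p ≡ map₁ suc q
  ∈-ord-∷⁻ {p} {c} {u} m with subst (p ∈_) (ord-∷ c u) m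
  ... | here eq = inj₁ eq
  ... | there m′ = inj₂ (∈-map⁻ (map₁ suc) m′)

  ∈-ord⇒< : ∀ {i b} u → (i , b) ∈ ord u → i < length u
  ∈-ord⇒< (c ∷ u) m with ∈-ord-∷⁻ m
  ... | inj₁ refl                   = s≤s z≤n
  ... | inj₂ ((_ , _) , m′ , refl) = s≤s (∈-ord⇒< u m′)

  <⇒∈-ord : ∀ {i} u → i < length u → ∃ λ b → (i , b) ∈ ord u
  <⇒∈-ord {zero}  (c ∷ u) _         = c , here refl
  <⇒∈-ord {suc i} (c ∷ u) (s≤s i<n) with <⇒∈-ord u i<n
  ... | b , m = b , ∈-ord-∷⁺ m

  ⊑-refl : {v : List (ℕ × B)} → v ⊑ v
  ⊑-refl _ m = m

  ⊑-trans : {v w x : List (ℕ × B)} → v ⊑ w → w ⊑ x → v ⊑ x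
  ⊑-trans v⊑w w⊑x p m = w⊑x p (v⊑w p m)

  ∷ʳ-⊑ : ∀ {v w : List (ℕ × B)} {p} → v ⊑ w → p ∈ w → (v ∷ʳ p) ⊑ w
  ∷ʳ-⊑ {v} v⊑w p∈w q m with ∈-++⁻ v m
  ... | inj₁ q∈v        = v⊑w q q∈v
  ... | inj₂ (here refl) = p∈w

  ord-⊑-∷ʳ : ∀ u b → ord u ⊑ ord (u ∷ʳ b)
  ord-⊑-∷ʳ u b p m = subst (p ∈_) (sym (ord-∷ʳ u b)) (∈-++⁺ˡ m)

  ord-⊑-∷⁻ : ∀ {c c′} u u′ → ord (c ∷ u) ⊑ ord (c′ ∷ u′) → ord u ⊑ ord u′
  ord-⊑-∷⁻ u u′ s (i , b) m with ∈-ord-∷⁻ (s _ (∈-ord-∷⁺ m))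
  ... | inj₂ ((_ , _) , m′ , refl) = m′

  ord-⊑⇒prefix : ∀ u u′ → ord u ⊑ ord u′ → ∃ λ w → u′ ≡ u ++ w
  ord-⊑⇒prefix []      u′ _ = u′ , refl
  ord-⊑⇒prefix (c ∷ u) [] s with s _ (here refl)
  ... | ()
  ord-⊑⇒prefix (c ∷ u) (c′ ∷ u′) s with ∈-ord-∷⁻ (s _ (here refl))
  ... | inj₂ ((_ , _) , _ , ())
  ... | inj₁ refl with ord-⊑⇒prefix u u′ (ord-⊑-∷⁻ u u′ s)
  ...   | w , refl = w , refl

  length-∷ʳ : ∀ (u : List B) b → length (u ∷ʳ b) ≡ suc (length u)
  length-∷ʳ u b = trans (length-++ u) (+-comm (length u) 1)

  tree-prefix : {T : Pred (List B)} → IsTree T → ∀ u w → T (u ++ w) → T u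
  tree-prefix {T} tree u []      t = subst T (++-identityʳ u) t
  tree-prefix {T} tree u (b ∷ w) t =
    tree u b (tree-prefix tree (u ∷ʳ b) w (subst T (sym (++-assoc u (b ∷ []) w)) t))

  monotone-extension : {T : Pred (List B)} → IsMonotone T → ∀ u w → T u → T (u ++ w)
  monotone-extension {T} mono u []      t = subst T (sym (++-identityʳ u)) t
  monotone-extension {T} mono u (b ∷ w) t =
    subst T (++-assoc u (b ∷ []) w) (monotone-extension mono (u ∷ʳ b) w (mono u b t))

  Productive-mono : {T T′ : Pred (List B)} → (∀ {u} → T u → T′ u) → Productive T → Productive T′
  Productive-mono T⊆T′ (X , x₀ , post) = X , x₀ , λ w x → T⊆T′ (proj₁ (post w x)) , proj₂ (post w x)

  Productive-cong : {T T′ : Pred (List B)} → (∀ u → T u ⇔ T′ u) → Productive T ⇔ Productive T′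
  Productive-cong T⇔T′ =
    mk⇔ (Productive-mono (Equivalence.to (T⇔T′ _))) (Productive-mono (Equivalence.from (T⇔T′ _)))

  HereditaryClosure-mono : {T T′ : Pred (List B)} → (∀ {u} → T u → T′ u) →
                           ∀ {u} → HereditaryClosure T u → HereditaryClosure T′ u
  HereditaryClosure-mono T⊆T′ (base t) = base (T⊆T′ t)
  HereditaryClosure-mono T⊆T′ (step h) = step λ b → HereditaryClosure-mono T⊆T′ (h b)

  InductivelyBarred-cong : {T T′ : Pred (List B)} → (∀ u → T u ⇔ T′ u) →
                           InductivelyBarred T ⇔ InductivelyBarred T′
  InductivelyBarred-cong T⇔T′ =
    mk⇔ (HereditaryClosure-mono (Equivalence.to (T⇔T′ _)))
        (HereditaryClosure-mono (Equivalence.from (T⇔T′ _)))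

  UpArb-closedUnderRestriction : {T : Pred (List (ℕ × B))} → ClosedUnderRestriction (UpArb T)
  UpArb-closedUnderRestriction v v′ v′⊑v (x , v⊑x , t) = x , ⊑-trans v′⊑v v⊑x , t

  UpMon-closedUnderExtension : {T : Pred (List (ℕ × B))} → ClosedUnderExtension (UpMon T)
  UpMon-closedUnderExtension v v′ (x , x⊑v , t) v⊑v′ = x , ⊑-trans x⊑v v⊑v′ , t

  ‖UpArb-hat‖⇔ : {T : Pred (List B)} → IsTree T → ∀ u → ‖ UpArb (hat T) ‖ u ⇔ T u
  ‖UpArb-hat‖⇔ {T} tree u = mk⇔ to (λ t → ord u , ⊑-refl , u , t , refl)
    where
    to : ‖ UpArb (hat T) ‖ u → T u
    to (_ , s , u′ , t , refl) with ord-⊑⇒prefix u u′ s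
    ... | w , refl = tree-prefix tree u w t

  ‖UpMon-hat‖⇔ : {T : Pred (List B)} → IsMonotone T → ∀ u → ‖ UpMon (hat T) ‖ u ⇔ T u
  ‖UpMon-hat‖⇔ {T} mono u = mk⇔ to (λ t → ord u , ⊑-refl , u , t , refl)
    where
    to : ‖ UpMon (hat T) ‖ u → T u
    to (_ , s , u′ , t , refl) with ord-⊑⇒prefix u′ u s
    ... | w , refl = monotone-extension mono u′ w t

  length∉dom-ord : ∀ u → ¬ InDom (length u) (ord u)
  length∉dom-ord u (_ , m) = n≮n (length u) (∈-ord⇒< u m)

  PruningPostFixed : Pred (List B) → Pred (List B) → Set
  PruningPostFixed T Y = ∀ w → Y w → T w × ∃ λ b → Y (w ∷ʳ b)

  longExtension : {T Y : Pred (List B)} → PruningPostFixed T Y →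
                  ∀ n {u} → Y u → ∃ λ u′ → Y u′ × ord u ⊑ ord u′ × n ≤ length u′
  longExtension post zero    y = _ , y , ⊑-refl , z≤n
  longExtension post (suc n) y with longExtension post n y
  ... | u′ , y′ , u⊑u′ , n≤u′ with proj₂ (post u′ y′)
  ...   | b , y″ = u′ ∷ʳ b , y″ , ⊑-trans u⊑u′ (ord-⊑-∷ʳ u′ b) ,
                   subst (suc n ≤_) (sym (length-∷ʳ u′ b)) (s≤s n≤u′)

  ordCover : Pred (List B) → Pred (List (ℕ × B))
  ordCover Y v = ∃ λ u → Y u × v ⊑ ord u

  approximable⇒productive : {T : Pred (List (ℕ × B))} → Approximable T → Productive ‖ T ‖
  approximable⇒productive (X , x₀ , post) = (λ u → X (ord u)) , x₀ , λ w x →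
    proj₁ (post (ord w) x) (ord w) ⊑-refl , extend w x
    where
    extend : ∀ w → X (ord w) → ∃ λ b → X (ord (w ∷ʳ b))
    extend w x with proj₂ (post (ord w) x) (length w) (length∉dom-ord w)
    ... | b , x′ = b , subst X (sym (ord-∷ʳ w b)) x′

  productive⇒approximable : {T : Pred (List (ℕ × B))} → ClosedUnderRestriction T →
                            Productive ‖ T ‖ → Approximable T
  productive⇒approximable {T} closed (Y , y₀ , Y-post) = ordCover Y , ([] , y₀ , λ _ ()) , post
    where
    post : ∀ w → ordCover Y w →
           Down T w × (∀ a → ¬ InDom a w → ∃ λ b → ordCover Y (w ∷ʳ (a , b)))
    post w (u , y , w⊑u) = (λ v v⊑w → closed (ord u) v (⊑-trans v⊑w w⊑u) (proj₁ (Y-post u y))) , extend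
      where
      extend : ∀ a → ¬ InDom a w → ∃ λ b → ordCover Y (w ∷ʳ (a , b))
      extend a _ with longExtension Y-post (suc a) y
      ... | u′ , y′ , u⊑u′ , a<u′ with <⇒∈-ord u′ a<u′
      ...   | b , m = b , u′ , y′ , ∷ʳ-⊑ (⊑-trans w⊑u u⊑u′) m

  HereditaryClosure-fromLong : {P : Pred (List B)} → ∀ k u →
    (∀ u′ → ord u ⊑ ord u′ → k + length u ≤ length u′ → HereditaryClosure P u′) →
    HereditaryClosure P u
  HereditaryClosure-fromLong zero    u long = long u ⊑-refl ≤-refl
  HereditaryClosure-fromLong (suc k) u long = step λ b →
    HereditaryClosure-fromLong k (u ∷ʳ b) λ u′ u∷ʳb⊑u′ k+≤ →
      long u′ (⊑-trans (ord-⊑-∷ʳ u b) u∷ʳb⊑u′) (subst (_≤ length u′) (lengthen b) k+≤)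
    where
    lengthen : ∀ b → k + length (u ∷ʳ b) ≡ suc k + length u
    lengthen b = trans (cong (k +_) (length-∷ʳ u b)) (+-suc k (length u))

  barClosure⇒hereditary : {T : Pred (List (ℕ × B))} → ClosedUnderExtension T →
    ∀ {v} → BarClosure T v → ∀ u → v ⊑ ord u → HereditaryClosure ‖ T ‖ u
  barClosure⇒hereditary closed (base (x , x⊑v , t)) u v⊑u = base (closed x (ord u) t (⊑-trans x⊑v v⊑u))
  barClosure⇒hereditary {T} closed (step a _ h) u v⊑u = HereditaryClosure-fromLong (suc a) u continue
    where
    continue : ∀ u′ → ord u ⊑ ord u′ → suc a + length u ≤ length u′ → HereditaryClosure ‖ T ‖ u′
    continue u′ u⊑u′ long with <⇒∈-ord u′ (≤-trans (m≤m+n (suc a) (length u)) long)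
    ... | b , m = barClosure⇒hereditary closed (h b) u′ (∷ʳ-⊑ (⊑-trans v⊑u u⊑u′) m)

  hereditary⇒barClosure : {T : Pred (List (ℕ × B))} → ∀ {u} → HereditaryClosure ‖ T ‖ u → BarClosure T (ord u)
  hereditary⇒barClosure {u = u} (base t) = base (ord u , ⊑-refl , t)
  hereditary⇒barClosure {T} {u} (step h) = step (length u) (length∉dom-ord u) λ b →
    subst (BarClosure T) (ord-∷ʳ u b) (hereditary⇒barClosure (h b))

  approximable⇔productive : {T : Pred (List (ℕ × B))} → ClosedUnderRestriction T →
                            Approximable T ⇔ Productive ‖ T ‖
  approximable⇔productive closed = mk⇔ approximable⇒productive (productive⇒approximable closed)

  barred⇔barred : {T : Pred (List (ℕ × B))} → ClosedUnderExtension T →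
                  InductivelyABBarred T ⇔ InductivelyBarred ‖ T ‖
  barred⇔barred closed = mk⇔ (λ bar → barClosure⇒hereditary closed bar [] (λ _ ())) hereditary⇒barClosure

proposition12 : (B : Set) →
    ((T : Pred (List (ℕ × B))) → ClosedUnderRestriction T →
       Approximable T ⇔ Productive ‖ T ‖)
    × ((T : Pred (List B)) → IsTree T →
       Approximable (UpArb (hat T)) ⇔ Productive T)
    × ((T : Pred (List (ℕ × B))) → ClosedUnderExtension T →
       InductivelyABBarred T ⇔ InductivelyBarred ‖ T ‖)
    × ((T : Pred (List B)) → IsMonotone T →
       InductivelyABBarred (UpMon (hat T)) ⇔ InductivelyBarred T)
proposition12 B =
    (λ T → approximable⇔productive)
  , (λ T tree → ⇔-trans (approximable⇔productive UpArb-closedUnderRestriction)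
                        (Productive-cong (‖UpArb-hat‖⇔ tree)))
  , (λ T → barred⇔barred)
  , (λ T mono → ⇔-trans (barred⇔barred UpMon-closedUnderExtension)
                        (InductivelyBarred-cong (‖UpMon-hat‖⇔ mono)))
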